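{- Let $\mathbb{P}=(P,\omega^\omega,\cdot)$ be a relative partial combinatory algebra and $\mathbf{j}$ an idempotent jump operator on $\mathbb{P}$. Then a partial multifunction $f\colon\subseteq\omega^\omega\rightrightarrows\omega^\omega$ is $(P_\mathbf{j},\mathbf{j})$-realizable if and only if it is $(P,\mathbf{j})$-realizable.
   Context: A relative pca is $(P,\omega^\omega,\cdot)$ with $P\subseteq\omega^\omega$ such that $(\omega^\omega,\cdot)$ and $(P,\cdot|_P)$ are partial combinatory algebras sharing combinators $\mathsf{s},\mathsf{k}$. Composition of partial multifunctions: $(h\circ g)(x)=\bigcup\{h(y):y\in g(x)\}$ if $g(x)$ is defined and $\subseteq\mathrm{dom}(h)$, else undefined; $a\mathbf{j}(x)=\{a\cdot y:y\in\mathbf{j}(x)\}$. $\mathbf{j}\colon\subseteq\omega^\omega\rightrightarrows\omega^\omega$ is an idempotent jump operator on $\mathbb{P}$ if (1) there is $u\in P$ with $a\mathbf{j}(x)=\mathbf{j}(uax)$ for all $a,x$; (2) there is $\iota\in P$ with $\{x\}=\mathbf{j}(\iota x)$ for all $x$; (3) there is $j_0\in P$ with $\mathbf{j}\circ\mathbf{j}(x)=\mathbf{j}(j_0x)$ for all $x$. If $\mathbf{j}(a)$ is a singleton, $a'$ is its element; $P_\mathbf{j}=\{a':a\in P,\ \mathbf{j}(a)\text{ a singleton}\}$. For $Q\subseteq\omega^\omega$, $f$ is $(Q,\mathbf{j})$-realizable if there is $a\in Q$ with $\mathbf{j}(a\cdot x)\subseteq f(x)$ for all $x\in\mathrm{dom}(f)$.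 -}

module Defs where

open import Data.Nat using (ℕ)
open import Data.Product using (Σ; Σ-syntax; _×_; _,_)
open import Data.Unit using (⊤)
open import Relation.Binary.PropositionalEquality using (_≡_)

Baire : Set
Baire = ℕ → ℕ

_⇔_ : Set → Set → Set
A ⇔ B = (A → B) × (B → A)
infix 1 _⇔_

-- A relative pca (P, ω^ω, ·).  Partial application is a functional
-- relation  App a b c  meaning  "a · b is defined and equals c".
record RelPCA : Set₁ where
  field
    P       : Baire → Set
    App     : Baire → Baire → Baire → Set
    App-fun : ∀ {a b c d} → App a b c → App a b d → c ≡ d
    k s     : Baire
    P-k     : P k
    P-s     : P s
    P-closed : ∀ {a b c} → P a → P b → App a b c → P c
    k-ax    : ∀ x y → Σ[ c ∈ Baire ] (App k x c × App c y x)
    s-def   : ∀ x y → Σ[ c ∈ Baire ] Σ[ d ∈ Baire ] (App s x c × App c y d)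
    s-ax    : ∀ x y z c d w → App s x c → App c y d →
              (App d z w ⇔ Σ[ u ∈ Baire ] Σ[ v ∈ Baire ] (App x z u × App y z v × App u v w))

record PMF : Set₁ where
  field
    dom      : Baire → Set
    val      : Baire → Baire → Set
    nonempty : ∀ {x} → dom x → Σ[ y ∈ Baire ] val x y
open PMF public

-- A possibly undefined subset of ω^ω (the value of a partial multi-valued expression)
record PSet : Set₁ where
  field
    def : Set
    mem : Baire → Set
open PSet public

_≃_ : PSet → PSet → Set
A ≃ B = (def A ⇔ def B) × (def A → def B → ∀ z → (mem A z ⇔ mem B z))
infix 3 _≃_

singletonPS : Baire → PSet
singletonPS x = record { def = ⊤ ; mem = λ z → z ≡ x }

module _ (R : RelPCA) (J : PMF) where
  open RelPCA R

  jApp1 : Baire → Baire → PSet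
  jApp1 e x = record
    { def = Σ[ d ∈ Baire ] (App e x d × dom J d)
    ; mem = λ z → Σ[ d ∈ Baire ] (App e x d × val J d z) }

  jApp2 : Baire → Baire → Baire → PSet
  jApp2 e a x = record
    { def = Σ[ c ∈ Baire ] Σ[ d ∈ Baire ] (App e a c × App c x d × dom J d)
    ; mem = λ z → Σ[ c ∈ Baire ] Σ[ d ∈ Baire ] (App e a c × App c x d × val J d z) }

  aJ : Baire → Baire → PSet
  aJ a x = record
    { def = dom J x × (∀ y → val J x y → Σ[ c ∈ Baire ] App a y c)
    ; mem = λ z → Σ[ y ∈ Baire ] (val J x y × App a y z) }

  jj : Baire → PSet
  jj x = record
    { def = dom J x × (∀ y → val J x y → dom J y)
    ; mem = λ z → Σ[ y ∈ Baire ] (val J x y × val J y z) }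

  record IsIdempotentJump : Set where
    field
      u      : Baire
      P-u    : P u
      u-ax   : ∀ a x → aJ a x ≃ jApp2 u a x
      ι      : Baire
      P-ι    : P ι
      ι-ax   : ∀ x → jApp1 ι x ≃ singletonPS x
      j₀     : Baire
      P-j₀   : P j₀
      j₀-ax  : ∀ x → jj x ≃ jApp1 j₀ x

  Pj : Baire → Set
  Pj z = Σ[ a ∈ Baire ] (P a × dom J a × (∀ y → val J a y ⇔ y ≡ z))

  Realizable : (Baire → Set) → PMF → Set
  Realizable Q f = Σ[ a ∈ Baire ] (Q a × (∀ x → dom f x →
                     def (jApp1 a x) × (∀ z → mem (jApp1 a x) z → val f x z)))

-- An element of P is already in P_j, since j(ι a) = {a} and ι a ∈ P. Conversely, if
-- z = a' with a ∈ P and j(a) = {z}, let t_x = λw. w x. Then t_x j(a) = {z x}, so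
-- j(u t_x a) = {z x} and j(j₀ (u t_x a)) = j(j(u t_x a)) = j(z x). Hence the P-element
-- b = λx. j₀ (u t_x a) satisfies j(b x) = j(z x) and realizes whatever z realizes.
module Submission where

open import Defs
open import Data.Product using (Σ; Σ-syntax; _×_; _,_; proj₁; proj₂)
open import Data.Unit using (tt)
open import Relation.Binary.PropositionalEquality using (_≡_; refl; sym; subst)

module Combinators (R : RelPCA) where
  open RelPCA R

  private variable
    x y z v w r : Baire

  k-app : ∀ {c} → App k x c → App c y w → w ≡ x
  k-app {x} {y} kx cy with k-ax x y
  ... | c , kx′ , cy′ with App-fun kx kx′
  ... | refl = App-fun cy cy′

  K : Baire → Baire
  K x = proj₁ (k-ax x x)

  k-app-K : App k x (K x)
  k-app-K {x} = proj₁ (proj₂ (k-ax x x))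

  K-app : App (K x) y x
  K-app {x} {y} with k-ax x y
  ... | c , kx , cy with App-fun kx (k-app-K {x})
  ... | refl = cy

  P-K : P x → P (K x)
  P-K px = P-closed P-k px k-app-K

  S₁ : Baire → Baire → Baire
  S₁ x y = proj₁ (s-def x y)

  S : Baire → Baire → Baire
  S x y = proj₁ (proj₂ (s-def x y))

  s-app-S₁ : App s x (S₁ x y)
  s-app-S₁ {x} {y} = proj₁ (proj₂ (proj₂ (s-def x y)))

  S₁-app-S : App (S₁ x y) y (S x y)
  S₁-app-S {x} {y} = proj₂ (proj₂ (proj₂ (s-def x y)))

  S₁-irrelevant : ∀ y′ → S₁ x y ≡ S₁ x y′
  S₁-irrelevant y′ = App-fun s-app-S₁ s-app-S₁

  P-S : P x → P y → P (S x y)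
  P-S px py = P-closed (P-closed P-s px s-app-S₁) py S₁-app-S

  S-app-intro : App x z v → App y z w → App v w r → App (S x y) z r
  S-app-intro xz yz vw = proj₂ (s-ax _ _ _ _ _ _ s-app-S₁ S₁-app-S) (_ , _ , xz , yz , vw)

  S-app-elim : App (S x y) z r →
               Σ[ v ∈ Baire ] Σ[ w ∈ Baire ] (App x z v × App y z w × App v w r)
  S-app-elim = proj₁ (s-ax _ _ _ _ _ _ s-app-S₁ S₁-app-S)

  I : Baire
  I = S k k

  P-I : P I
  P-I = P-S P-k P-k

  I-app : App I x x
  I-app = S-app-intro k-app-K k-app-K K-app

  I-app⇒≡ : App I x r → r ≡ x
  I-app⇒≡ Ix with S-app-elim Ix
  ... | _ , _ , kx , _ , vw = k-app kx vw

  -- evalAt x is t_x = λw. w x.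
  evalAt : Baire → Baire
  evalAt x = S I (K x)

  evalAt-app⇐ : App w x r → App (evalAt x) w r
  evalAt-app⇐ wx = S-app-intro I-app K-app wx

  evalAt-app⇒ : App (evalAt x) w r → App w x r
  evalAt-app⇒ {x} ev with S-app-elim ev
  ... | _ , _ , Iw , Kxw , vw with I-app⇒≡ Iw | App-fun Kxw (K-app {x})
  ... | refl | refl = vw

  -- E = s (k (s i)) k, so that E x = s i (k x) = t_x.
  E : Baire
  E = S (K (S₁ I I)) k

  P-E : P E
  P-E = P-S (P-K (P-closed P-s P-I s-app-S₁)) P-k

  E-app : App E x (evalAt x)
  E-app {x} = S-app-intro K-app k-app-K
                (subst (λ e → App e (K x) (evalAt x)) (S₁-irrelevant I) S₁-app-S)

  -- compEval p q r is λx. r (p t_x q).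
  compEval : Baire → Baire → Baire → Baire
  compEval p q r = S (K r) (S (S (K p) E) (K q))

  P-compEval : ∀ {p q r} → P p → P q → P r → P (compEval p q r)
  P-compEval pp pq pr = P-S (P-K pr) (P-S (P-S (P-K pp) P-E) (P-K pq))

  compEval-app : ∀ {p q r c₁ c d} →
                 App p (evalAt x) c₁ → App c₁ q c → App r c d → App (compEval p q r) x d
  compEval-app pt c₁q rc =
    S-app-intro K-app (S-app-intro (S-app-intro K-app E-app pt) K-app c₁q) rc

_⊑_ : PSet → PSet → Set
A ⊑ B = def A → def B × (∀ z → mem B z → mem A z)
infix 4 _⊑_

⊑-refl : ∀ {A} → A ⊑ A
⊑-refl dA = dA , λ _ m → m

realizable-transfer : (R : RelPCA) (J : PMF) {Q Q′ : Baire → Set} →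
  (∀ {a} → Q a → Σ[ b ∈ Baire ] (Q′ b × ∀ x → jApp1 R J a x ⊑ jApp1 R J b x)) →
  (f : PMF) → Realizable R J Q f → Realizable R J Q′ f
realizable-transfer R J simulate f (a , Qa , realizes) with simulate Qa
... | b , Q′b , a⊑b = b , Q′b , λ x dx → realizes-b x dx
  where
  realizes-b : ∀ x → dom f x →
               def (jApp1 R J b x) × (∀ z → mem (jApp1 R J b x) z → val f x z)
  realizes-b x dx with realizes x dx
  ... | da , sub with a⊑b x da
  ... | db , b⊆a = db , λ z m → sub z (b⊆a z m)

module Jump (R : RelPCA) (J : PMF) (IJ : IsIdempotentJump R J) where
  open RelPCA R
  open IsIdempotentJump IJ
  open Combinators R

  -- j(c) = {e}: the inclusion suffices, as values of a PMF are nonempty.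
  JumpsTo : Baire → Baire → Set
  JumpsTo c e = dom J c × (∀ w → val J c w → w ≡ e)

  jApp1-mem⇒val : ∀ {a x d w} → App a x d → mem (jApp1 R J a x) w → val J d w
  jApp1-mem⇒val ax (d′ , ax′ , v) with App-fun ax′ ax
  ... | refl = v

  P⊆Pj : ∀ {a} → P a → Pj R J a
  P⊆Pj {a} Pa = d , P-closed P-ι Pa ιa , dom-d , λ y → to y , from y
    where
    ι-a = ι-ax a
    defined : def (jApp1 R J ι a)
    defined = proj₂ (proj₁ ι-a) tt
    d = proj₁ defined
    ιa = proj₁ (proj₂ defined)
    dom-d = proj₂ (proj₂ defined)
    to : ∀ y → val J d y → y ≡ a
    to y v = proj₁ (proj₂ ι-a defined tt y) (d , ιa , v)
    from : ∀ y → y ≡ a → val J d y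
    from y y≡a = jApp1-mem⇒val ιa (proj₂ (proj₂ ι-a defined tt y) y≡a)

  u-evalAt-jumpsTo : ∀ {a z x e} → JumpsTo a z → App z x e →
    Σ[ c₁ ∈ Baire ] Σ[ c ∈ Baire ] (App u (evalAt x) c₁ × App c₁ a c × JumpsTo c e)
  u-evalAt-jumpsTo {a} {z} {x} {e} (dom-a , a↦z) zx =
    c₁ , c , uc₁ , c₁a , dom-c , c↦e
    where
    u-a = u-ax (evalAt x) a
    tx-defined : def (aJ R J (evalAt x) a)
    tx-defined =
      dom-a , λ y v → e , evalAt-app⇐ (subst (λ y → App y x e) (sym (a↦z y v)) zx)
    defined : def (jApp2 R J u (evalAt x) a)
    defined = proj₁ (proj₁ u-a) tx-defined
    c₁ = proj₁ defined
    c = proj₁ (proj₂ defined)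
    uc₁ = proj₁ (proj₂ (proj₂ defined))
    c₁a = proj₁ (proj₂ (proj₂ (proj₂ defined)))
    dom-c = proj₂ (proj₂ (proj₂ (proj₂ defined)))
    c↦e : ∀ w → val J c w → w ≡ e
    c↦e w v with proj₂ (proj₂ u-a tx-defined defined w) (c₁ , c , uc₁ , c₁a , v)
    ... | y , vy , tx-y with a↦z y vy
    ... | refl = App-fun (evalAt-app⇒ tx-y) zx

  j₀-jumpsTo : ∀ {c e} → JumpsTo c e → dom J e →
    Σ[ d ∈ Baire ] (App j₀ c d × dom J d × (∀ w → val J d w → val J e w))
  j₀-jumpsTo {c} {e} (dom-c , c↦e) dom-e = d , j₀c , dom-d , d⊆e
    where
    j₀-c = j₀-ax c
    jj-defined : def (jj R J c)
    jj-defined = dom-c , λ y v → subst (dom J) (sym (c↦e y v)) dom-e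
    defined : def (jApp1 R J j₀ c)
    defined = proj₁ (proj₁ j₀-c) jj-defined
    d = proj₁ defined
    j₀c = proj₁ (proj₂ defined)
    dom-d = proj₂ (proj₂ defined)
    d⊆e : ∀ w → val J d w → val J e w
    d⊆e w v with proj₂ (proj₂ j₀-c jj-defined defined w) (d , j₀c , v)
    ... | y , vy , yw with c↦e y vy
    ... | refl = yw

  Pj-simulated-in-P : ∀ {z} → Pj R J z →
    Σ[ b ∈ Baire ] (P b × ∀ x → jApp1 R J z x ⊑ jApp1 R J b x)
  Pj-simulated-in-P {z} (a , Pa , dom-a , a↦z) =
    compEval u a j₀ , P-compEval P-u Pa P-j₀ , simulates
    where
    simulates : ∀ x → jApp1 R J z x ⊑ jApp1 R J (compEval u a j₀) x
    simulates x (e , zx , dom-e)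
      with u-evalAt-jumpsTo (dom-a , λ y → proj₁ (a↦z y)) zx
    ... | c₁ , c , uc₁ , c₁a , c↦e with j₀-jumpsTo c↦e dom-e
    ... | d , j₀c , dom-d , d⊆e =
      (d , bx , dom-d) , λ w m → e , zx , d⊆e w (jApp1-mem⇒val bx m)
      where
      bx = compEval-app uc₁ c₁a j₀c

lemma2p5 : (R : RelPCA) (J : PMF) → IsIdempotentJump R J →
    (f : PMF) → Realizable R J (Pj R J) f ⇔ Realizable R J (RelPCA.P R) f
lemma2p5 R J IJ f =
    realizable-transfer R J Pj-simulated-in-P f
  , realizable-transfer R J (λ Pa → _ , P⊆Pj Pa , λ _ → ⊑-refl) f
  where open Jump R J IJ
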